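{- Let $G$ be a connected graph with minimum degree at least 3 and let $R$ and $R'$ be rotation systems on $G$. If $\mathsf L(R')=\mathsf L(R)$, then either $R'=R$ or $R'=R^*$.
   Context: A rotation system $R=\langle G,T\rangle$ consists of a graph $G$ and a ternary relation $T$ on $V(G)$ such that $T(a,b,c)$ implies $b,c\in\Gamma(a)$ (the neighbourhood of $a$), and for every vertex $a$ the binary relation $T_a(b,c)=T(a,b,c)$ is a directed cycle on $\Gamma(a)$ (each $b$ has exactly one successor and one predecessor, and $T_a$ is connected). Its conjugate is $R^*=\langle G,T^*\rangle$ with $T^*(a,b,c)=T(a,c,b)$. For $a\in V(G)$ let $s_a,p_a$ be the successor and predecessor functions on $\Gamma(a)$: $c=s_a(b)$ and $b=p_a(c)$ iff $T(a,b,c)$. The layout system $\mathsf L(R)=\langle G,T_L,Q\rangle$ is defined by $T_L(a,b,c)\iff T(a,b,c)\vee T(a,c,b)$, and the quaternary relation $Q$ holds exactly on the tuples $(p_{a_1}(a_2),a_1,a_2,s_{a_2}(a_1))$ and $(s_{a_1}(a_2),a_1,a_2,p_{a_2}(a_1))$ for all pairs of adjacent vertices $a_1,a_2$. -}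

module Defs where

open import Data.Nat using (ℕ; _≥_)
open import Data.Bool using (Bool; T)
open import Data.Fin using (Fin)
open import Data.List using (List; length; filter; allFin)
open import Data.Product using (_×_; Σ; ∃; ∃-syntax)
open import Data.Sum using (_⊎_)
open import Relation.Binary.PropositionalEquality using (_≡_)
open import Relation.Nullary using (¬_)
open import Data.Bool.Properties using (T?)

record Graph : Set where
  field
    n      : ℕ
    adj    : Fin n → Fin n → Bool
    sym    : ∀ a b → adj a b ≡ adj b a
    irrefl : ∀ a → ¬ T (adj a a)

module _ (G : Graph) where
  open Graph G

  V : Set
  V = Fin n

  Adj : V → V → Set
  Adj a b = T (adj a b)

  degree : V → ℕ
  degree a = length (filter (λ b → T? (adj a b)) (allFin n))

  MinDegreeAtLeast : ℕ → Set
  MinDegreeAtLeast k = ∀ a → degree a ≥ k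

  data Walk : V → V → Set where
    here : ∀ {a} → Walk a a
    step : ∀ {a b c} → Adj a b → Walk b c → Walk a c

  Connected : Set
  Connected = ∀ a b → Walk a b

  Ternary : Set₁
  Ternary = V → V → V → Set

  data Reach (T' : Ternary) (a : V) : V → V → Set where
    here : ∀ {b} → Reach T' a b b
    step : ∀ {b c d} → T' a b c → Reach T' a c d → Reach T' a b d

  -- T_a is a directed cycle on Γ(a)
  record IsRotationSystem (T' : Ternary) : Set where
    field
      inNbhd      : ∀ a b c → T' a b c → Adj a b × Adj a c
      successor   : ∀ a b → Adj a b → ∃[ c ] T' a b c
      succUnique  : ∀ a b c c' → T' a b c → T' a b c' → c ≡ c'
      predecessor : ∀ a c → Adj a c → ∃[ b ] T' a b c
      predUnique  : ∀ a b b' c → T' a b c → T' a b' c → b ≡ b'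
      connected   : ∀ a b c → Adj a b → Adj a c → Reach T' a b c

  record RotationSystem : Set₁ where
    field
      Rel   : Ternary
      isRot : IsRotationSystem Rel

  open RotationSystem

  conjRel : Ternary → Ternary
  conjRel T' a b c = T' a c b

  -- layout system L(R) = ⟨G, T_L, Q⟩
  TL : RotationSystem → Ternary
  TL R a b c = Rel R a b c ⊎ Rel R a c b

  -- Q(w,a1,a2,z) iff a1 ~ a2 and
  --   (w = p_{a1}(a2) and z = s_{a2}(a1))  or  (w = s_{a1}(a2) and z = p_{a2}(a1))
  Q : RotationSystem → V → V → V → V → Set
  Q R w a₁ a₂ z = Adj a₁ a₂ ×
    ((Rel R a₁ w a₂ × Rel R a₂ a₁ z) ⊎ (Rel R a₁ a₂ w × Rel R a₂ z a₁))

  _≐₃_ : Ternary → Ternary → Set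
  S ≐₃ S' = ∀ a b c → (S a b c → S' a b c) × (S' a b c → S a b c)

  _≐₄_ : (V → V → V → V → Set) → (V → V → V → V → Set) → Set
  S ≐₄ S' = ∀ a b c d → (S a b c d → S' a b c d) × (S' a b c d → S a b c d)

  SameLayout : RotationSystem → RotationSystem → Set
  SameLayout R R' = (TL R ≐₃ TL R') × (Q R ≐₄ Q R')

  SameRot : RotationSystem → RotationSystem → Set
  SameRot R' R = Rel R' ≐₃ Rel R

  IsConjugateOf : RotationSystem → RotationSystem → Set
  IsConjugateOf R' R = Rel R' ≐₃ conjRel (Rel R)

{-# OPTIONS --safe #-}
module Submission where

-- Since every vertex has degree at least 3, no rotation T_a contains both b → c and c → b.
-- Hence at each vertex a the relation T_L forces T′_a to be T_a or its reverse: once T′_a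
-- shares an arc with one of them, following the cycle T′_a it shares every arc. The relation
-- Q rules out the two choices differing at the ends of an edge, and connectivity spreads the
-- choice made at one vertex to all of G.

open import Defs
open import Data.Bool using (T)
open import Data.Bool.Properties using (T?)
open import Data.Empty using (⊥-elim)
open import Data.Fin using (Fin)
open import Data.List using (List; []; _∷_; length; filter; allFin)
open import Data.List.Relation.Unary.All as All using (All; _∷_)
open import Data.List.Relation.Unary.All.Properties using (all-filter)
open import Data.List.Relation.Unary.AllPairs using (_∷_)
open import Data.List.Relation.Unary.Unique.Propositional using (Unique)
open import Data.List.Relation.Unary.Unique.Propositional.Properties using (allFin⁺; filter⁺)
open import Data.Nat using (ℕ; zero; suc; _≤_; _<_; s≤s; z≤n)
open import Data.Nat.Properties using (≤-trans)
open import Data.Product using (_×_; _,_; proj₁; proj₂; ∃)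
import Data.Product as Product
open import Data.Sum using (_⊎_; inj₁; inj₂; [_,_])
import Data.Sum as Sum
open import Relation.Binary.PropositionalEquality using (_≡_; refl; subst)
open import Relation.Nullary using (¬_)
open import Function using (_∘_)

two-of-three-coincide : ∀ {A : Set} {b c x y z : A} →
  x ≡ b ⊎ x ≡ c → y ≡ b ⊎ y ≡ c → z ≡ b ⊎ z ≡ c → x ≡ y ⊎ x ≡ z ⊎ y ≡ z
two-of-three-coincide (inj₁ refl) (inj₁ refl) _           = inj₁ refl
two-of-three-coincide (inj₂ refl) (inj₂ refl) _           = inj₁ refl
two-of-three-coincide (inj₁ refl) (inj₂ refl) (inj₁ refl) = inj₂ (inj₁ refl)
two-of-three-coincide (inj₂ refl) (inj₁ refl) (inj₂ refl) = inj₂ (inj₁ refl)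
two-of-three-coincide (inj₁ refl) (inj₂ refl) (inj₂ refl) = inj₂ (inj₂ refl)
two-of-three-coincide (inj₂ refl) (inj₁ refl) (inj₁ refl) = inj₂ (inj₂ refl)

unique-within-pair⇒length<3 : ∀ {A : Set} {b c : A} {xs : List A} →
  Unique xs → All (λ x → x ≡ b ⊎ x ≡ c) xs → ¬ 3 ≤ length xs
unique-within-pair⇒length<3
  ((x≢y ∷ x≢z ∷ _) ∷ (y≢z ∷ _) ∷ _) (x∈ ∷ y∈ ∷ z∈ ∷ _) _ =
  [ x≢y , [ x≢z , y≢z ] ] (two-of-three-coincide x∈ y∈ z∈)
unique-within-pair⇒length<3 {xs = []}         _ _ ()
unique-within-pair⇒length<3 {xs = _ ∷ []}     _ _ (s≤s ())
unique-within-pair⇒length<3 {xs = _ ∷ _ ∷ []} _ _ (s≤s (s≤s ()))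

All-witness : ∀ {A : Set} {P : A → Set} {xs : List A} → All P xs → 0 < length xs → ∃ P
All-witness (p ∷ _) _ = _ , p

empty-or-inhabited : (m : ℕ) → ¬ Fin m ⊎ Fin m
empty-or-inhabited zero    = inj₁ (λ ())
empty-or-inhabited (suc m) = inj₂ Fin.zero

module _ (G : Graph) where
  open Graph G using (n; adj)
  open RotationSystem
  open IsRotationSystem

  Γ : V G → List (V G)
  Γ a = filter (λ b → T? (adj a b)) (allFin n)

  Γ-unique : ∀ a → Unique (Γ a)
  Γ-unique a = filter⁺ (λ b → T? (adj a b)) (allFin⁺ n)

  Γ-adjacent : ∀ a → All (Adj G a) (Γ a)
  Γ-adjacent a = all-filter (λ b → T? (adj a b)) (allFin n)

  neighbour : ∀ {a} → 0 < degree G a → ∃ (Adj G a)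
  neighbour {a} = All-witness (Γ-adjacent a)

  Reach-snoc : ∀ {S : Ternary G} {a b c d} → Reach G S a b c → S a c d → Reach G S a b d
  Reach-snoc here       t′ = step t′ here
  Reach-snoc (step t r) t′ = step t (Reach-snoc r t′)

  Reach-reverse : ∀ {S : Ternary G} {a b c} → Reach G S a b c → Reach G (conjRel G S) a c b
  Reach-reverse here       = here
  Reach-reverse (step t r) = Reach-snoc (Reach-reverse r) t

  conjugate : RotationSystem G → RotationSystem G
  conjugate R = record
    { Rel   = conjRel G (Rel R)
    ; isRot = record
      { inNbhd      = λ a b c t → Product.swap (inNbhd R.isRot a c b t)
      ; successor   = predecessor R.isRot
      ; succUnique  = λ a b c c′ t t′ → predUnique R.isRot a c c′ b t t′
      ; predecessor = successor R.isRot
      ; predUnique  = λ a b b′ c t t′ → succUnique R.isRot a c b b′ t t′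
      ; connected   = λ a b c ab ac → Reach-reverse (connected R.isRot a c b ac ab)
      }
    }
    where module R = RotationSystem R

  rotation-asymmetric : (R : RotationSystem G) → ∀ {a b c} →
    3 ≤ degree G a → Rel R a b c → ¬ Rel R a c b
  rotation-asymmetric R {a} {b} {c} δa bc cb =
    unique-within-pair⇒length<3 (Γ-unique a)
      (All.map (λ ax → stays-in-pair (connected (isRot R) a b _ ab ax) (inj₁ refl))
               (Γ-adjacent a))
      δa
    where
    ab : Adj G a b
    ab = proj₁ (inNbhd (isRot R) a b c bc)
    stays-in-pair : ∀ {x y} → Reach G (Rel R) a x y → x ≡ b ⊎ x ≡ c → y ≡ b ⊎ y ≡ c
    stays-in-pair here       p           = p
    stays-in-pair (step t r) (inj₁ refl) = stays-in-pair r (inj₂ (succUnique (isRot R) a b _ c t bc))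
    stays-in-pair (step t r) (inj₂ refl) = stays-in-pair r (inj₁ (succUnique (isRot R) a c _ b t cb))

  AgreeAt : RotationSystem G → RotationSystem G → V G → Set
  AgreeAt R′ R a = ∀ b c → (Rel R′ a b c → Rel R a b c) × (Rel R a b c → Rel R′ a b c)

  -- If R′ and R share the arc x → y at a, they share the R′-arc y → d: otherwise R a d y,
  -- which with R a x y forces d = x, a 2-cycle of R′ at a.
  agreeAt-from-arc : (R′ R : RotationSystem G) → ∀ {a b₀ c₀} → 3 ≤ degree G a →
    (∀ b c → Rel R′ a b c → TL G R a b c) →
    Rel R′ a b₀ c₀ → Rel R a b₀ c₀ → AgreeAt R′ R a
  agreeAt-from-arc R′ R {a} {b₀} {c₀} δa R′⊆TL r₀ s₀ _ _ = forward , backward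
    where
    module R′ = IsRotationSystem (isRot R′)
    module R  = IsRotationSystem (isRot R)

    SuccessorAgrees : V G → Set
    SuccessorAgrees x = ∀ {d} → Rel R′ a x d → Rel R a x d

    base : SuccessorAgrees b₀
    base r = subst (Rel R a b₀) (R′.succUnique a b₀ c₀ _ r₀ r) s₀

    next : ∀ {x y} → SuccessorAgrees x → Rel R′ a x y → SuccessorAgrees y
    next {x} {y} agrees t {d} r with R′⊆TL y d r
    ... | inj₁ s = s
    ... | inj₂ s with R.predUnique a d x y s (agrees t)
    ... | refl = ⊥-elim (rotation-asymmetric R′ δa t r)

    along : ∀ {x y} → Reach G (Rel R′) a x y → SuccessorAgrees x → SuccessorAgrees y
    along here       agrees = agrees
    along (step t r) agrees = along r (next agrees t)

    forward : ∀ {b c} → Rel R′ a b c → Rel R a b c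
    forward {b} {c} r = along (R′.connected a b₀ b (proj₁ (R′.inNbhd a b₀ c₀ r₀))
                                                   (proj₁ (R′.inNbhd a b c r))) base r

    backward : ∀ {b c} → Rel R a b c → Rel R′ a b c
    backward {b} {c} s with R′.successor a b (proj₁ (R.inNbhd a b c s))
    ... | c′ , r = subst (Rel R′ a b) (R.succUnique a b c′ c (forward r) s) r

  sameLayout-conjugateʳ : ∀ R′ R → SameLayout G R′ R → SameLayout G R′ (conjugate R)
  sameLayout-conjugateʳ R′ R (tl , q) =
    (λ a b c → Sum.swap ∘ proj₁ (tl a b c) , proj₂ (tl a b c) ∘ Sum.swap) ,
    (λ w a₁ a₂ z → Product.map₂ Sum.swap ∘ proj₁ (q w a₁ a₂ z) ,
                   proj₂ (q w a₁ a₂ z) ∘ Product.map₂ Sum.swap)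

  arc⇒TL : ∀ R′ R → SameLayout G R′ R → ∀ a b c → Rel R′ a b c → TL G R a b c
  arc⇒TL R′ R L a b c r = proj₁ (proj₁ L a b c) (inj₁ r)

  agreeAt-or-conjugate : ∀ R′ R → SameLayout G R′ R → ∀ {a} → 3 ≤ degree G a →
    AgreeAt R′ R a ⊎ AgreeAt R′ (conjugate R) a
  agreeAt-or-conjugate R′ R L {a} δa
    with neighbour (≤-trans (s≤s z≤n) δa)
  ... | b₀ , ab₀ with successor (isRot R′) a b₀ ab₀
  ... | c₀ , r₀ with arc⇒TL R′ R L a b₀ c₀ r₀
  ... | inj₁ s = inj₁ (agreeAt-from-arc R′ R δa (arc⇒TL R′ R L a) r₀ s)
  ... | inj₂ s = inj₂ (agreeAt-from-arc R′ (conjugate R) δa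
                         (arc⇒TL R′ (conjugate R) (sameLayout-conjugateʳ R′ R L) a) r₀ s)

  -- The Q-tuple (p_{a₁}(a₂), a₁, a₂, s_{a₂}(a₁)) of R is one of the two Q-tuples of R′ on
  -- the edge a₁a₂; either way R′ reverses an arc of R at a₁ or at a₂.
  ¬agreeAt-conjugate-across-edge : ∀ R′ R → SameLayout G R′ R → ∀ {a₁ a₂} →
    3 ≤ degree G a₁ → 3 ≤ degree G a₂ → Adj G a₁ a₂ →
    AgreeAt R′ R a₁ → ¬ AgreeAt R′ (conjugate R) a₂
  ¬agreeAt-conjugate-across-edge R′ R L {a₁} {a₂} δ₁ δ₂ e agree₁ agree₂
    with predecessor (isRot R) a₁ a₂ e
       | successor (isRot R) a₂ a₁ (subst T (Graph.sym G a₁ a₂) e)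
  ... | w , rw | z , rz with proj₂ (proj₂ L w a₁ a₂ z) (e , inj₁ (rw , rz))
  ... | _ , inj₁ (_ , r′z) = rotation-asymmetric R δ₂ rz (proj₁ (agree₂ a₁ z) r′z)
  ... | _ , inj₂ (r′w , _) = rotation-asymmetric R δ₁ rw (proj₁ (agree₁ a₂ w) r′w)

  module _ (δ : MinDegreeAtLeast G 3) (R′ R : RotationSystem G) (L : SameLayout G R′ R) where

    agreeAt-adjacent : ∀ {a₁ a₂} → Adj G a₁ a₂ → AgreeAt R′ R a₁ → AgreeAt R′ R a₂
    agreeAt-adjacent {a₁} {a₂} e agree₁ with agreeAt-or-conjugate R′ R L (δ a₂)
    ... | inj₁ agree₂ = agree₂
    ... | inj₂ agree₂ =
      ⊥-elim (¬agreeAt-conjugate-across-edge R′ R L (δ a₁) (δ a₂) e agree₁ agree₂)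

    agreeAt-walk : ∀ {x y} → Walk G x y → AgreeAt R′ R x → AgreeAt R′ R y
    agreeAt-walk here       agree = agree
    agreeAt-walk (step e w) agree = agreeAt-walk w (agreeAt-adjacent e agree)

lemma23 : (G : Graph) → Connected G → MinDegreeAtLeast G 3 →
            (R R' : RotationSystem G) →
            SameLayout G R' R →
            SameRot G R' R ⊎ IsConjugateOf G R' R
lemma23 G conn δ R R' L with empty-or-inhabited (Graph.n G)
... | inj₁ no-vertex = inj₁ (λ a → ⊥-elim (no-vertex a))
... | inj₂ v with agreeAt-or-conjugate G R' R L (δ v)
... | inj₁ agree = inj₁ (λ a → agreeAt-walk G δ R' R L (conn v a) agree)
... | inj₂ agree = inj₂ (λ a → agreeAt-walk G δ R' (conjugate G R)
                                  (sameLayout-conjugateʳ G R' R L) (conn v a) agree)
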